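{- Let $n\ge 2$ and let $\mathcal{G}=\mathcal{H}\cup\left\{\sum_{i\in[n]\setminus\{j\}}x_i-1 : j\in[n]\right\}$ be the constraint set of the Set Cover instance. Let $h_1(\mathbf{x})=\sum_{i=1}^n x_i-1$ and $h_2(\mathbf{x})=\left(\sum_{i=1}^n x_i\right)\left(\sum_{i=1}^n x_i-2\right)$. Then $h_1\in\Sigma^{\mathcal{G}}_{n,0}$ and $h_2\in\Sigma^{\mathcal{G}}_{n,1}$.
   Context: $\Sigma_{n,d}$ is the set of finite sums of squares of real polynomials in $x_1,\dots,x_n$ of degree at most $d$; $\mathcal{H}=\{\pm(x_i^2-x_i):i\in[n]\}$. For a finite set $\mathcal{G}\supseteq\mathcal{H}$ of polynomials, $\Sigma^{\mathcal{G}}_{n,d}$ is the set of polynomials $s_0+\sum_i s_i g_i$ (finite sum) with $g_i\in\mathcal{G}$, $s_i\in\Sigma_{n,d}$, $s_0\in\Sigma_{n,2\lceil(2d+\deg(\mathcal{G}))/2\rceil}$, where $\deg(\mathcal{G})$ is the maximum degree of an element of $\mathcal{G}$. -}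

module Defs where

open import Level using (Level; _⊔_) renaming (suc to lsuc)
open import Data.Nat using (ℕ; zero; suc)
import Data.Nat as N
open import Data.Fin using (Fin; _≟_)
open import Data.List using (List; []; _∷_; map; filter; _++_; concatMap)
open import Data.List.Relation.Unary.All using (All)
open import Data.List.Relation.Unary.Any using (Any)
open import Data.List.Membership.Propositional using (_∈_)
open import Data.Vec using (Vec; toList)
open import Data.Product using (Σ; ∃; _×_; _,_)
open import Relation.Nullary using (¬_; ¬?)
open import Relation.Binary.Structures using (IsTotalOrder)
open import Algebra.Bundles using (CommutativeRing)

-- Real closed fields (the reals are not available in agda-stdlib; the
-- statement is quantified over every real closed field, which includes ℝ).

module _ {c ℓ} (R : CommutativeRing c ℓ) where
  open CommutativeRing R
  horner : Carrier → List Carrier → Carrier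
  horner x []       = 0#
  horner x (a ∷ as) = a + x * horner x as

record RealClosedField (c ℓ₁ ℓ₂ : Level) : Set (lsuc (c ⊔ ℓ₁ ⊔ ℓ₂)) where
  field
    cring : CommutativeRing c ℓ₁
  open CommutativeRing cring public
  field
    _≤ᴿ_        : Carrier → Carrier → Set ℓ₂
    isTotalOrder : IsTotalOrder _≈_ _≤ᴿ_
    +-mono-≤ᴿ   : ∀ {x y} z → x ≤ᴿ y → (x + z) ≤ᴿ (y + z)
    *-nonneg    : ∀ {x y} → 0# ≤ᴿ x → 0# ≤ᴿ y → 0# ≤ᴿ (x * y)
    0≉1         : ¬ (0# ≈ 1#)
    inverse     : ∀ x → ¬ (x ≈ 0#) → ∃ λ y → (x * y) ≈ 1#
    sqrt        : ∀ x → 0# ≤ᴿ x → ∃ λ y → (y * y) ≈ x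
    -- every polynomial of odd degree 2k+1 has a root
    oddRoot     : ∀ k (cs : Vec Carrier (suc (2 N.* k))) (lead : Carrier) →
                  ¬ (lead ≈ 0#) →
                  ∃ λ x → horner cring x (toList cs ++ (lead ∷ [])) ≈ 0#

module Poly {c ℓ₁ ℓ₂} (R : RealClosedField c ℓ₁ ℓ₂) where
  open RealClosedField R

  data Pol (n : ℕ) : Set c where
    con  : Carrier → Pol n
    var  : Fin n → Pol n
    _⊕_  : Pol n → Pol n → Pol n
    _⊗_  : Pol n → Pol n → Pol n

  infixl 6 _⊕_ _⊝_
  infixl 7 _⊗_

  _⊝_ : ∀ {n} → Pol n → Pol n → Pol n
  p ⊝ q = p ⊕ con (- 1#) ⊗ q

  ⟦_⟧ : ∀ {n} → Pol n → (Fin n → Carrier) → Carrier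
  ⟦ con a ⟧ x = a
  ⟦ var i ⟧ x = x i
  ⟦ p ⊕ q ⟧ x = ⟦ p ⟧ x + ⟦ q ⟧ x
  ⟦ p ⊗ q ⟧ x = ⟦ p ⟧ x * ⟦ q ⟧ x

  -- syntactic degree bound of an expression
  sdeg : ∀ {n} → Pol n → ℕ
  sdeg (con _) = 0
  sdeg (var _) = 1
  sdeg (p ⊕ q) = sdeg p N.⊔ sdeg q
  sdeg (p ⊗ q) = sdeg p N.+ sdeg q

  -- equality of polynomials (R is infinite, so equality of polynomial
  -- functions on Rⁿ coincides with equality of coefficients)
  _≐_ : ∀ {n} → Pol n → Pol n → Set (c ⊔ ℓ₁)
  p ≐ q = ∀ x → ⟦ p ⟧ x ≈ ⟦ q ⟧ x

  DegLe : ∀ {n} → Pol n → ℕ → Set (c ⊔ ℓ₁)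
  DegLe p d = ∃ λ q → sdeg q N.≤ d × p ≐ q

  HasDeg : ∀ {n} → Pol n → ℕ → Set (c ⊔ ℓ₁)
  HasDeg p D = DegLe p D × (∀ e → DegLe p e → D N.≤ e)

  MaxDeg : ∀ {n} → List (Pol n) → ℕ → Set (c ⊔ ℓ₁)
  MaxDeg G D = All (λ g → DegLe g D) G × Any (λ g → HasDeg g D) G

  sumP : ∀ {n} → List (Pol n) → Pol n
  sumP []       = con 0#
  sumP (p ∷ ps) = p ⊕ sumP ps

  sumSq : ∀ {n} → List (Pol n) → Pol n
  sumSq ps = sumP (map (λ q → q ⊗ q) ps)

  SOS : ∀ {n} → ℕ → Pol n → Set (c ⊔ ℓ₁)
  SOS d p = ∃ λ (qs : List (Pol _)) → All (λ q → sdeg q N.≤ d) qs × p ≐ sumSq qs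

  sumMul : ∀ {n} → List (Pol n × Pol n) → Pol n
  sumMul []            = con 0#
  sumMul ((s , g) ∷ t) = s ⊗ g ⊕ sumMul t

  SigmaG : ∀ {n} → List (Pol n) → ℕ → Pol n → Set (c ⊔ ℓ₁)
  SigmaG {n} G d p =
    ∃ λ D → MaxDeg G D ×
    ∃ λ (s₀ : Pol n) → SOS (2 N.* N.⌈ 2 N.* d N.+ D /2⌉) s₀ ×
    ∃ λ (ts : List (Pol n × Pol n)) →
      All (λ { (s , g) → g ∈ G × SOS d s }) ts ×
      p ≐ (s₀ ⊕ sumMul ts)

  allVars : (n : ℕ) → List (Fin n)
  allVars n = Data.List.allFin n

  𝓗 : (n : ℕ) → List (Pol n)
  𝓗 n = concatMap (λ i → (var i ⊗ var i ⊝ var i) ∷ (con (- 1#) ⊗ (var i ⊗ var i ⊝ var i)) ∷ []) (allVars n)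

  coverCon : (n : ℕ) → Fin n → Pol n
  coverCon n j = sumP (map var (filter (λ i → ¬? (i ≟ j)) (allVars n))) ⊝ con 1#

  𝒢 : (n : ℕ) → List (Pol n)
  𝒢 n = 𝓗 n ++ map (coverCon n) (allVars n)

  sumX : (n : ℕ) → Pol n
  sumX n = sumP (map var (allVars n))

  h₁ : (n : ℕ) → Pol n
  h₁ n = sumX n ⊝ con 1#

  h₂ : (n : ℕ) → Pol n
  h₂ n = sumX n ⊗ (sumX n ⊝ con (1# + 1#))

{-# OPTIONS --safe #-}
-- With gⱼ = Σ_{i≠j} xᵢ − 1 ∈ 𝒢 and bⱼ = xⱼ² − xⱼ ∈ 𝓗 we have
--   h₁ = x₀² + g₀ − b₀,
--   xⱼ (Σ x − 2) = xⱼ² gⱼ + ((2 − gⱼ)/2)² bⱼ − (gⱼ/2)² bⱼ,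
-- since gⱼ + xⱼ = Σ x − 1; summing the second identity over j gives h₂.
-- The degree of 𝒢 is 2: the values 0, 0, 2 of b₀ at 0, e₀, 2e₀ are not those
-- of an affine function, and 2 ≠ 0 in an ordered field.
module Submission where

open import Defs
open import Data.Nat using (ℕ; _≤_)
open import Data.Product using (_×_)

open import Algebra.Bundles using (CommutativeRing)
open import Algebra.Solver.Ring.AlmostCommutativeRing
  using (_-Raw-AlmostCommutative⟶_; fromCommutativeRing)
open import Data.Empty using (⊥-elim)
open import Data.Fin using (Fin; _≟_) renaming (zero to fzero; suc to fsuc)
open import Data.Integer as ℤ using (ℤ; +_; -[1+_]; _⊖_; _◃_; sign; ∣_∣)
import Data.Integer.Properties as ℤ
open import Data.List using (List; []; _∷_; map; filter; concatMap; allFin)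
open import Data.List.Properties using (map-tabulate)
open import Data.List.Relation.Unary.All using (All; []; _∷_; universal)
open import Data.List.Relation.Unary.All.Properties using (++⁺; concat⁺; map⁺)
open import Data.List.Relation.Unary.Any using (here; there)
open import Data.List.Membership.Propositional using (_∈_; lose)
open import Data.List.Membership.Propositional.Properties
  using (∈-map⁺; ∈-++⁺ˡ; ∈-++⁺ʳ; ∈-allFin; ∈-concatMap⁺)
open import Data.Maybe using (Maybe; just; nothing)
open import Data.Nat as ℕ using (zero; suc; z≤n; s≤s)
import Data.Nat.Properties as ℕ
open import Data.Product using (_,_; proj₁; proj₂)
open import Data.Sign as Sign using (Sign)
open import Data.Sum using (_⊎_; inj₁; inj₂)
open import Function using (_∘_)
open import Relation.Binary.PropositionalEquality as ≡ using (_≡_)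
open import Relation.Binary.Structures using (IsTotalOrder)
open import Relation.Nullary using (¬_; ¬?; yes; no)

module IntegerCoefficientRingSolver {c ℓ} (CR : CommutativeRing c ℓ) where
  open CommutativeRing CR
  open import Algebra.Properties.Ring ring
    using (-0#≈0#; -‿distribˡ-*; -‿distribʳ-*; -‿involutive; -‿+-comm; xyx⁻¹≈y)
  open import Algebra.Properties.Semiring.Mult.TCOptimised semiring
    using (1+×; ×-homo-+; ×1-homo-*) renaming (_×_ to _×′_)
  open import Relation.Binary.Reasoning.Setoid setoid

  -- _×′_ is the multiple with 1 ×′ x = x, so that fromℤ (+ 1), fromℤ (+ 2) and
  -- fromℤ -[1+ 0 ] are 1#, 1# + 1# and - 1# on the nose: the solver's proofs rely on this.
  fromℤ : ℤ → Carrier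
  fromℤ (+ n)    = n ×′ 1#
  fromℤ -[1+ n ] = - (suc n ×′ 1#)

  1+a-[1+b]≈a-b : ∀ a b → (1# + a) - (1# + b) ≈ a - b
  1+a-[1+b]≈a-b a b = begin
    (1# + a) - (1# + b)     ≈⟨ +-congˡ (-‿cong (+-comm 1# b)) ⟩
    (1# + a) - (b + 1#)     ≈⟨ +-congˡ (-‿+-comm b 1#) ⟨
    (1# + a) + (- b - 1#)   ≈⟨ +-assoc 1# a (- b - 1#) ⟩
    1# + (a + (- b - 1#))   ≈⟨ +-congˡ (+-assoc a (- b) (- 1#)) ⟨
    1# + ((a - b) - 1#)     ≈⟨ +-assoc 1# (a - b) (- 1#) ⟨
    1# + (a - b) - 1#       ≈⟨ xyx⁻¹≈y 1# (a - b) ⟩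
    a - b                   ∎

  fromℤ-⊖ : ∀ m n → fromℤ (m ⊖ n) ≈ m ×′ 1# - n ×′ 1#
  fromℤ-⊖ m       zero    = sym (trans (+-congˡ -0#≈0#) (+-identityʳ _))
  fromℤ-⊖ zero    (suc n) = sym (+-identityˡ _)
  fromℤ-⊖ (suc m) (suc n) = begin
    fromℤ (suc m ⊖ suc n)            ≡⟨ ≡.cong fromℤ (ℤ.[1+m]⊖[1+n]≡m⊖n m n) ⟩
    fromℤ (m ⊖ n)                    ≈⟨ fromℤ-⊖ m n ⟩
    m ×′ 1# - n ×′ 1#                ≈⟨ 1+a-[1+b]≈a-b (m ×′ 1#) (n ×′ 1#) ⟨
    (1# + m ×′ 1#) - (1# + n ×′ 1#)  ≈⟨ +-cong (1+× m 1#) (-‿cong (1+× n 1#)) ⟨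
    suc m ×′ 1# - suc n ×′ 1#        ∎

  fromℤ-+ : ∀ i j → fromℤ (i ℤ.+ j) ≈ fromℤ i + fromℤ j
  fromℤ-+ (+ m)    (+ n)    = ×-homo-+ 1# m n
  fromℤ-+ (+ m)    -[1+ n ] = fromℤ-⊖ m (suc n)
  fromℤ-+ -[1+ m ] (+ n)    = trans (fromℤ-⊖ n (suc m)) (+-comm _ _)
  fromℤ-+ -[1+ m ] -[1+ n ] = begin
    - (suc (suc m ℕ.+ n) ×′ 1#)    ≡⟨ ≡.cong (λ k → - (k ×′ 1#)) (ℕ.+-suc (suc m) n) ⟨
    - ((suc m ℕ.+ suc n) ×′ 1#)    ≈⟨ -‿cong (×-homo-+ 1# (suc m) (suc n)) ⟩
    - (suc m ×′ 1# + suc n ×′ 1#)  ≈⟨ -‿+-comm _ _ ⟨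
    - (suc m ×′ 1#) - suc n ×′ 1#  ∎

  signed : Sign → Carrier → Carrier
  signed Sign.+ x = x
  signed Sign.- x = - x

  signed-cong : ∀ s {x y} → x ≈ y → signed s x ≈ signed s y
  signed-cong Sign.+ x≈y = x≈y
  signed-cong Sign.- x≈y = -‿cong x≈y

  signed-* : ∀ s t x y → signed (s Sign.* t) (x * y) ≈ signed s x * signed t y
  signed-* Sign.+ Sign.+ x y = refl
  signed-* Sign.+ Sign.- x y = -‿distribʳ-* x y
  signed-* Sign.- Sign.+ x y = -‿distribˡ-* x y
  signed-* Sign.- Sign.- x y = begin
    x * y           ≈⟨ -‿involutive (x * y) ⟨
    - - (x * y)     ≈⟨ -‿cong (-‿distribʳ-* x y) ⟩
    - (x * - y)     ≈⟨ -‿distribˡ-* x (- y) ⟩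
    - x * - y       ∎

  fromℤ-◃ : ∀ s n → fromℤ (s ◃ n) ≈ signed s (n ×′ 1#)
  fromℤ-◃ Sign.+ zero    = refl
  fromℤ-◃ Sign.- zero    = sym -0#≈0#
  fromℤ-◃ Sign.+ (suc n) = refl
  fromℤ-◃ Sign.- (suc n) = refl

  fromℤ-* : ∀ i j → fromℤ (i ℤ.* j) ≈ fromℤ i * fromℤ j
  fromℤ-* i j = begin
    fromℤ (s ◃ ∣ i ∣ ℕ.* ∣ j ∣)
      ≈⟨ fromℤ-◃ s (∣ i ∣ ℕ.* ∣ j ∣) ⟩
    signed s ((∣ i ∣ ℕ.* ∣ j ∣) ×′ 1#)
      ≈⟨ signed-cong s (×1-homo-* ∣ i ∣ ∣ j ∣) ⟩
    signed s ((∣ i ∣ ×′ 1#) * (∣ j ∣ ×′ 1#))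
      ≈⟨ signed-* (sign i) (sign j) _ _ ⟩
    signed (sign i) (∣ i ∣ ×′ 1#) * signed (sign j) (∣ j ∣ ×′ 1#)
      ≈⟨ *-cong (fromℤ-◃ (sign i) ∣ i ∣) (fromℤ-◃ (sign j) ∣ j ∣) ⟨
    fromℤ (sign i ◃ ∣ i ∣) * fromℤ (sign j ◃ ∣ j ∣)
      ≡⟨ ≡.cong₂ (λ a b → fromℤ a * fromℤ b) (ℤ.◃-inverse i) (ℤ.◃-inverse j) ⟩
    fromℤ i * fromℤ j
      ∎
    where s = sign i Sign.* sign j

  fromℤ-neg : ∀ i → fromℤ (ℤ.- i) ≈ - fromℤ i
  fromℤ-neg (+ zero)  = sym -0#≈0#
  fromℤ-neg (+ suc n) = refl
  fromℤ-neg -[1+ n ]  = sym (-‿involutive _)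

  fromℤ-homomorphism : ℤ.+-*-rawRing -Raw-AlmostCommutative⟶ fromCommutativeRing CR
  fromℤ-homomorphism = record
    { ⟦_⟧    = fromℤ
    ; +-homo = fromℤ-+
    ; *-homo = fromℤ-*
    ; -‿homo = fromℤ-neg
    ; 0-homo = refl
    ; 1-homo = refl
    }

  fromℤ-≟ : ∀ i j → Maybe (fromℤ i ≈ fromℤ j)
  fromℤ-≟ i j with i ℤ.≟ j
  ... | yes ≡.refl = just refl
  ... | no  _      = nothing

  open import Algebra.Solver.Ring
    ℤ.+-*-rawRing (fromCommutativeRing CR) fromℤ-homomorphism fromℤ-≟ public

m+n≤1⇒m≤0⊎n≤0 : ∀ m {n} → m ℕ.+ n ≤ 1 → m ≤ 0 ⊎ n ≤ 0
m+n≤1⇒m≤0⊎n≤0 zero    _           = inj₁ z≤n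
m+n≤1⇒m≤0⊎n≤0 (suc m) (s≤s m+n≤0) = inj₂ (ℕ.m+n≤o⇒n≤o m m+n≤0)

module OrderedField {c ℓ₁ ℓ₂} (R : RealClosedField c ℓ₁ ℓ₂) where
  open RealClosedField R
  open IntegerCoefficientRingSolver cring using (solve; _:=_; _:*_) renaming (con to κ)
  private module ≤ᴿ = IsTotalOrder isTotalOrder

  ≤ᴿ-resp-≈ : ∀ {x x′ y y′} → x ≈ x′ → y ≈ y′ → x ≤ᴿ y → x′ ≤ᴿ y′
  ≤ᴿ-resp-≈ x≈x′ y≈y′ = ≤ᴿ.≲-respʳ-≈ y≈y′ ∘ ≤ᴿ.≲-respˡ-≈ x≈x′

  2# : Carrier
  2# = 1# + 1#

  0≤1 : 0# ≤ᴿ 1#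
  0≤1 with ≤ᴿ.total 0# 1#
  ... | inj₁ le  = le
  ... | inj₂ 1≤0 = ⊥-elim (0≉1 (sym (≤ᴿ.antisym 1≤0 0≤[-1]²)))
    where
      0≤-1 : 0# ≤ᴿ (- 1#)
      0≤-1 = ≤ᴿ-resp-≈ (-‿inverseʳ 1#) (+-identityˡ (- 1#)) (+-mono-≤ᴿ (- 1#) 1≤0)
      [-1]²≈1 : - 1# * - 1# ≈ 1#
      [-1]²≈1 = solve 0 (κ -[1+ 0 ] :* κ -[1+ 0 ] := κ (+ 1)) refl
      0≤[-1]² : 0# ≤ᴿ 1#
      0≤[-1]² = ≤ᴿ.≲-respʳ-≈ [-1]²≈1 (*-nonneg 0≤-1 0≤-1)

  2#≉0 : ¬ (2# ≈ 0#)
  2#≉0 2≈0 = 0≉1 (sym (≤ᴿ.antisym 1≤0 0≤1))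
    where
      1≤0 : 1# ≤ᴿ 0#
      1≤0 = ≤ᴿ-resp-≈ (+-identityˡ 1#) 2≈0 (+-mono-≤ᴿ 1# 0≤1)

  ½ : Carrier
  ½ = proj₁ (inverse 2# 2#≉0)

  2#*½≈1# : 2# * ½ ≈ 1#
  2#*½≈1# = proj₂ (inverse 2# 2#≉0)

module Certificates {c ℓ₁ ℓ₂} (R : RealClosedField c ℓ₁ ℓ₂) where
  open RealClosedField R
  open Poly R
  open OrderedField R
  open IntegerCoefficientRingSolver cring
    using (Polynomial; solve; _:=_; _:+_; _:*_) renaming (con to κ)
  open import Algebra.Properties.CommutativeSemigroup +-commutativeSemigroup using (interchange)
  open import Relation.Binary.Reasoning.Setoid setoid

  infixl 6 _⊝ᵛ_ _:⊝_

  -- The values of p ⊝ q and square p, in the form in which ⟦_⟧ computes them.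
  _⊝ᵛ_ : Carrier → Carrier → Carrier
  a ⊝ᵛ b = a + - 1# * b

  squareᵛ : Carrier → Carrier
  squareᵛ a = a * a + 0#

  _:⊝_ : ∀ {m} → Polynomial m → Polynomial m → Polynomial m
  a :⊝ b = a :+ κ -[1+ 0 ] :* b

  :square : ∀ {m} → Polynomial m → Polynomial m
  :square a = a :* a :+ κ (+ 0)

  booleanity : ∀ {n} → Fin n → Pol n
  booleanity i = var i ⊗ var i ⊝ var i

  ±booleanity : ∀ {n} → Fin n → List (Pol n)
  ±booleanity i = booleanity i ∷ con (- 1#) ⊗ booleanity i ∷ []

  others : ∀ {n} → Fin n → List (Fin n)
  others {n} j = filter (λ i → ¬? (i ≟ j)) (allFin n)

  square : ∀ {n} → Pol n → Pol n
  square p = sumSq (p ∷ [])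

  square-SOS : ∀ {n} d (p : Pol n) → sdeg p ≤ d → SOS d (square p)
  square-SOS d p p≤d = p ∷ [] , p≤d ∷ [] , λ _ → refl

  sdeg-DegLe : ∀ {n d} (p : Pol n) → sdeg p ≤ d → DegLe p d
  sdeg-DegLe p p≤d = p , p≤d , λ _ → refl

  sdeg≤0⇒constant : ∀ {n} (p : Pol n) → sdeg p ≤ 0 → ∀ x y → ⟦ p ⟧ x ≈ ⟦ p ⟧ y
  sdeg≤0⇒constant (con a) _     x y = refl
  sdeg≤0⇒constant (p ⊕ q) p⊕q≤0 x y =
    +-cong (sdeg≤0⇒constant p (ℕ.m⊔n≤o⇒m≤o (sdeg p) (sdeg q) p⊕q≤0) x y)
           (sdeg≤0⇒constant q (ℕ.m⊔n≤o⇒n≤o (sdeg p) (sdeg q) p⊕q≤0) x y)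
  sdeg≤0⇒constant (p ⊗ q) p⊗q≤0 x y =
    *-cong (sdeg≤0⇒constant p (ℕ.m+n≤o⇒m≤o (sdeg p) p⊗q≤0) x y)
           (sdeg≤0⇒constant q (ℕ.m+n≤o⇒n≤o (sdeg p) p⊗q≤0) x y)

  midpoint-*ˡ : ∀ k {a b c} → a + c ≈ b + b → k * a + k * c ≈ k * b + k * b
  midpoint-*ˡ k {a} {b} {c} a+c≈b+b = begin
    k * a + k * c  ≈⟨ distribˡ k a c ⟨
    k * (a + c)    ≈⟨ *-congˡ a+c≈b+b ⟩
    k * (b + b)    ≈⟨ distribˡ k b b ⟩
    k * b + k * b  ∎

  midpoint-*ʳ : ∀ k {a b c} → a + c ≈ b + b → a * k + c * k ≈ b * k + b * k
  midpoint-*ʳ k {a} {b} {c} a+c≈b+b = begin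
    a * k + c * k  ≈⟨ distribʳ k a c ⟨
    (a + c) * k    ≈⟨ *-congʳ a+c≈b+b ⟩
    (b + b) * k    ≈⟨ distribʳ k b b ⟩
    b * k + b * k  ∎

  sdeg≤1⇒midpoint-affine : ∀ {n} (p : Pol n) → sdeg p ≤ 1 → ∀ {x y z} →
    (∀ i → x i + z i ≈ y i + y i) → ⟦ p ⟧ x + ⟦ p ⟧ z ≈ ⟦ p ⟧ y + ⟦ p ⟧ y
  sdeg≤1⇒midpoint-affine (con a) _ _ = refl
  sdeg≤1⇒midpoint-affine (var i) _ mid = mid i
  sdeg≤1⇒midpoint-affine (p ⊕ q) p⊕q≤1 {x} {y} {z} mid = begin
    (⟦ p ⟧ x + ⟦ q ⟧ x) + (⟦ p ⟧ z + ⟦ q ⟧ z)  ≈⟨ interchange _ _ _ _ ⟩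
    (⟦ p ⟧ x + ⟦ p ⟧ z) + (⟦ q ⟧ x + ⟦ q ⟧ z)  ≈⟨ +-cong
      (sdeg≤1⇒midpoint-affine p (ℕ.m⊔n≤o⇒m≤o (sdeg p) (sdeg q) p⊕q≤1) mid)
      (sdeg≤1⇒midpoint-affine q (ℕ.m⊔n≤o⇒n≤o (sdeg p) (sdeg q) p⊕q≤1) mid) ⟩
    (⟦ p ⟧ y + ⟦ p ⟧ y) + (⟦ q ⟧ y + ⟦ q ⟧ y)  ≈⟨ interchange _ _ _ _ ⟩
    (⟦ p ⟧ y + ⟦ q ⟧ y) + (⟦ p ⟧ y + ⟦ q ⟧ y)  ∎
  sdeg≤1⇒midpoint-affine (p ⊗ q) p⊗q≤1 {x} {y} {z} mid
    with m+n≤1⇒m≤0⊎n≤0 (sdeg p) p⊗q≤1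
  ... | inj₁ p≤0 = trans
    (+-cong (*-congʳ (constant-p x y)) (*-congʳ (constant-p z y)))
    (midpoint-*ˡ (⟦ p ⟧ y) (sdeg≤1⇒midpoint-affine q (ℕ.m+n≤o⇒n≤o (sdeg p) p⊗q≤1) mid))
    where constant-p = sdeg≤0⇒constant p p≤0
  ... | inj₂ q≤0 = trans
    (+-cong (*-congˡ (constant-q x y)) (*-congˡ (constant-q z y)))
    (midpoint-*ʳ (⟦ q ⟧ y) (sdeg≤1⇒midpoint-affine p (ℕ.m+n≤o⇒m≤o (sdeg p) p⊗q≤1) mid))
    where constant-q = sdeg≤0⇒constant q q≤0

  _·e₀ : ∀ {n} → Carrier → Fin (suc n) → Carrier
  (t ·e₀) fzero    = t
  (t ·e₀) (fsuc _) = 0#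

  booleanity-not-affine : ∀ {n} (p : Pol (suc n)) → sdeg p ≤ 1 → ¬ (booleanity fzero ≐ p)
  booleanity-not-affine p p≤1 b≐p = 2#≉0 (begin
    2#                                 ≈⟨ values-at-0-and-2e₀ ⟨
    (0# * 0# ⊝ᵛ 0#) + (2# * 2# ⊝ᵛ 2#)  ≈⟨ +-cong (b≐p (0# ·e₀)) (b≐p (2# ·e₀)) ⟩
    ⟦ p ⟧ (0# ·e₀) + ⟦ p ⟧ (2# ·e₀)    ≈⟨ sdeg≤1⇒midpoint-affine p p≤1 e₀-midpoint ⟩
    ⟦ p ⟧ (1# ·e₀) + ⟦ p ⟧ (1# ·e₀)    ≈⟨ +-cong (b≐p (1# ·e₀)) (b≐p (1# ·e₀)) ⟨
    (1# * 1# ⊝ᵛ 1#) + (1# * 1# ⊝ᵛ 1#)  ≈⟨ values-at-e₀ ⟩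
    0#                                 ∎)
    where
      e₀-midpoint : ∀ i → (0# ·e₀) i + (2# ·e₀) i ≈ (1# ·e₀) i + (1# ·e₀) i
      e₀-midpoint fzero    = +-identityˡ 2#
      e₀-midpoint (fsuc _) = refl
      values-at-0-and-2e₀ : (0# * 0# ⊝ᵛ 0#) + (2# * 2# ⊝ᵛ 2#) ≈ 2#
      values-at-0-and-2e₀ = solve 0
        ((κ (+ 0) :* κ (+ 0) :⊝ κ (+ 0)) :+ (κ (+ 2) :* κ (+ 2) :⊝ κ (+ 2)) := κ (+ 2)) refl
      values-at-e₀ : (1# * 1# ⊝ᵛ 1#) + (1# * 1# ⊝ᵛ 1#) ≈ 0#
      values-at-e₀ = solve 0
        ((κ (+ 1) :* κ (+ 1) :⊝ κ (+ 1)) :+ (κ (+ 1) :* κ (+ 1) :⊝ κ (+ 1)) := κ (+ 0)) refl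

  booleanity-HasDeg-2 : ∀ {n} → HasDeg (booleanity {suc n} fzero) 2
  booleanity-HasDeg-2 = sdeg-DegLe (booleanity fzero) ℕ.≤-refl , minimal
    where
      minimal : ∀ e → DegLe (booleanity fzero) e → 2 ≤ e
      minimal 0             (p , p≤0 , b≐p) = ⊥-elim (booleanity-not-affine p (ℕ.m≤n⇒m≤1+n p≤0) b≐p)
      minimal 1             (p , p≤1 , b≐p) = ⊥-elim (booleanity-not-affine p p≤1 b≐p)
      minimal (suc (suc e)) _               = s≤s (s≤s z≤n)

  sumVars-sdeg : ∀ {n} (L : List (Fin n)) → sdeg (sumP (map var L)) ≤ 1
  sumVars-sdeg []      = z≤n
  sumVars-sdeg (i ∷ L) = ℕ.⊔-lub ℕ.≤-refl (sumVars-sdeg L)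

  coverCon-sdeg : ∀ n j → sdeg (coverCon n j) ≤ 1
  coverCon-sdeg n j = ℕ.⊔-lub (sumVars-sdeg (others j)) z≤n

  𝒢-MaxDeg : ∀ n → MaxDeg (𝒢 (suc n)) 2
  𝒢-MaxDeg n =
    ++⁺ (concat⁺ (map⁺ (universal ±booleanity-DegLe (allFin (suc n)))))
        (map⁺ (universal coverCon-DegLe (allFin (suc n))))
    , here booleanity-HasDeg-2
    where
      ±booleanity-DegLe : ∀ i → All (λ g → DegLe g 2) (±booleanity i)
      ±booleanity-DegLe i =
        sdeg-DegLe (booleanity i) ℕ.≤-refl ∷ sdeg-DegLe (con (- 1#) ⊗ booleanity i) ℕ.≤-refl ∷ []
      coverCon-DegLe : ∀ j → DegLe (coverCon (suc n) j) 2
      coverCon-DegLe j = sdeg-DegLe (coverCon (suc n) j) (ℕ.m≤n⇒m≤1+n (coverCon-sdeg (suc n) j))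

  coverCon∈𝒢 : ∀ n j → coverCon n j ∈ 𝒢 n
  coverCon∈𝒢 n j = ∈-++⁺ʳ (𝓗 n) (∈-map⁺ (coverCon n) (∈-allFin j))

  booleanity∈𝒢 : ∀ n j → booleanity j ∈ 𝒢 n
  booleanity∈𝒢 n j =
    ∈-++⁺ˡ (∈-concatMap⁺ ±booleanity (lose (∈-allFin j) (here ≡.refl)))

  -booleanity∈𝒢 : ∀ n j → con (- 1#) ⊗ booleanity j ∈ 𝒢 n
  -booleanity∈𝒢 n j =
    ∈-++⁺ˡ (∈-concatMap⁺ ±booleanity (lose (∈-allFin j) (there (here ≡.refl))))

  sumVars : ∀ {n} → List (Fin n) → (Fin n → Carrier) → Carrier
  sumVars L = ⟦ sumP (map var L) ⟧

  allFin-suc : ∀ n → allFin (suc n) ≡ fzero ∷ map fsuc (allFin n)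
  allFin-suc n = ≡.cong (fzero ∷_) (≡.sym (map-tabulate (λ i → i) fsuc))

  filter-≢fzero : ∀ {n} (L : List (Fin n)) →
    filter (λ i → ¬? (i ≟ fzero)) (map fsuc L) ≡ map fsuc L
  filter-≢fzero []      = ≡.refl
  filter-≢fzero (i ∷ L) = ≡.cong (fsuc i ∷_) (filter-≢fzero L)

  filter-≢fsuc : ∀ {n} (j : Fin n) L →
    filter (λ i → ¬? (i ≟ fsuc j)) (map fsuc L) ≡ map fsuc (filter (λ i → ¬? (i ≟ j)) L)
  filter-≢fsuc j []      = ≡.refl
  filter-≢fsuc j (i ∷ L) with i ≟ j
  ... | yes _ = filter-≢fsuc j L
  ... | no  _ = ≡.cong (fsuc i ∷_) (filter-≢fsuc j L)

  sumVars-map-fsuc : ∀ {n} (L : List (Fin n)) x →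
    sumVars (map fsuc L) x ≡ sumVars L (x ∘ fsuc)
  sumVars-map-fsuc []      x = ≡.refl
  sumVars-map-fsuc (i ∷ L) x = ≡.cong (λ s → x (fsuc i) + s) (sumVars-map-fsuc L x)

  sum-others+xⱼ : ∀ n (j : Fin n) x → sumVars (others j) x + x j ≈ ⟦ sumX n ⟧ x
  sum-others+xⱼ (suc n) j x =
    ≡.subst (λ L → sumVars (filter (λ i → ¬? (i ≟ j)) L) x + x j ≈ sumVars L x)
            (≡.sym (allFin-suc n)) (split j)
    where
      split : ∀ j → sumVars (filter (λ i → ¬? (i ≟ j)) (fzero ∷ map fsuc (allFin n))) x + x j
                  ≈ sumVars (fzero ∷ map fsuc (allFin n)) x
      split fzero rewrite filter-≢fzero (allFin n) = +-comm _ _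
      split (fsuc j) rewrite filter-≢fsuc j (allFin n) = begin
        (x fzero + sumVars (map fsuc (others j)) x) + x (fsuc j)
          ≡⟨ ≡.cong (λ s → (x fzero + s) + x (fsuc j)) (sumVars-map-fsuc (others j) x) ⟩
        (x fzero + sumVars (others j) (x ∘ fsuc)) + x (fsuc j)
          ≈⟨ +-assoc _ _ _ ⟩
        x fzero + (sumVars (others j) (x ∘ fsuc) + x (fsuc j))
          ≈⟨ +-congˡ (sum-others+xⱼ n j (x ∘ fsuc)) ⟩
        x fzero + sumVars (allFin n) (x ∘ fsuc)
          ≡⟨ ≡.cong (λ s → x fzero + s) (sumVars-map-fsuc (allFin n) x) ⟨
        x fzero + sumVars (map fsuc (allFin n)) x
          ∎

  h₁-identity : ∀ t y →
    (t + y) ⊝ᵛ 1# ≈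
    squareᵛ y + (squareᵛ 1# * (t ⊝ᵛ 1#) + (squareᵛ 1# * (- 1# * (y * y ⊝ᵛ y)) + 0#))
  h₁-identity = solve 2 (λ t y →
    (t :+ y) :⊝ κ (+ 1) :=
    :square y :+ (:square (κ (+ 1)) :* (t :⊝ κ (+ 1))
      :+ (:square (κ (+ 1)) :* (κ -[1+ 0 ] :* (y :* y :⊝ y)) :+ κ (+ 0)))) refl

  h₁∈Σ𝒢 : ∀ n → SigmaG (𝒢 (suc n)) 0 (h₁ (suc n))
  h₁∈Σ𝒢 n =
    2 , 𝒢-MaxDeg n , square (var fzero) , square-SOS 2 (var fzero) (s≤s z≤n) ,
    (one , coverCon (suc n) fzero) ∷ (one , con (- 1#) ⊗ booleanity fzero) ∷ [] ,
    (coverCon∈𝒢 (suc n) fzero , one-SOS) ∷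
      (-booleanity∈𝒢 (suc n) fzero , one-SOS) ∷ [] ,
    λ x → trans (+-congʳ (sym (sum-others+xⱼ (suc n) fzero x))) (h₁-identity _ (x fzero))
    where
      one : Pol (suc n)
      one = square (con 1#)
      one-SOS : SOS 0 one
      one-SOS = square-SOS 0 (con 1#) z≤n

  h₂-identity : ∀ y t k r →
    squareᵛ y * (t ⊝ᵛ 1#)
      + (squareᵛ (k * (2# ⊝ᵛ (t ⊝ᵛ 1#))) * (y * y ⊝ᵛ y)
      + (squareᵛ (k * (t ⊝ᵛ 1#)) * (- 1# * (y * y ⊝ᵛ y)) + r)) ≈
    (y * ((t + y) ⊝ᵛ 2#)
      + ((2# * k) * (2# * k) ⊝ᵛ 1#) * ((2# ⊝ᵛ t) * (y * y ⊝ᵛ y))) + r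
  h₂-identity = solve 4 (λ y t k r →
    :square y :* (t :⊝ κ (+ 1))
      :+ (:square (k :* (κ (+ 2) :⊝ (t :⊝ κ (+ 1)))) :* (y :* y :⊝ y)
      :+ (:square (k :* (t :⊝ κ (+ 1))) :* (κ -[1+ 0 ] :* (y :* y :⊝ y)) :+ r)) :=
    (y :* ((t :+ y) :⊝ κ (+ 2))
      :+ ((κ (+ 2) :* k) :* (κ (+ 2) :* k) :⊝ κ (+ 1)) :* ((κ (+ 2) :⊝ t) :* (y :* y :⊝ y))) :+ r)
    refl

  [2#*½]²⊝1≈0 : (2# * ½) * (2# * ½) ⊝ᵛ 1# ≈ 0#
  [2#*½]²⊝1≈0 = trans (+-congʳ (*-cong 2#*½≈1# 2#*½≈1#))
    (solve 0 (κ (+ 1) :* κ (+ 1) :⊝ κ (+ 1) := κ (+ 0)) refl)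

  ½[2-g] ½g : ∀ {n} → Fin n → Pol n
  ½[2-g] {n} j = con ½ ⊗ (con 2# ⊝ coverCon n j)
  ½g     {n} j = con ½ ⊗ coverCon n j

  cover-terms : ∀ {n} → Fin n → List (Pol n × Pol n)
  cover-terms {n} j =
    (square (var j) , coverCon n j) ∷
    (square (½[2-g] j) , booleanity j) ∷
    (square (½g j) , con (- 1#) ⊗ booleanity j) ∷ []

  cover-terms-sum : ∀ n (L : List (Fin n)) x →
    ⟦ sumMul (concatMap cover-terms L) ⟧ x ≈ sumVars L x * (⟦ sumX n ⟧ x ⊝ᵛ 2#)
  cover-terms-sum n []      x = sym (zeroˡ _)
  cover-terms-sum n (j ∷ L) x = begin
    ⟦ sumMul (concatMap cover-terms (j ∷ L)) ⟧ x
      ≈⟨ h₂-identity (x j) t ½ (⟦ sumMul (concatMap cover-terms L) ⟧ x) ⟩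
    (x j * ((t + x j) ⊝ᵛ 2#)
      + ((2# * ½) * (2# * ½) ⊝ᵛ 1#) * ((2# ⊝ᵛ t) * (x j * x j ⊝ᵛ x j)))
      + ⟦ sumMul (concatMap cover-terms L) ⟧ x
      ≈⟨ +-cong (+-cong (*-congˡ (+-congʳ (sum-others+xⱼ n j x)))
                        (trans (*-congʳ [2#*½]²⊝1≈0) (zeroˡ _)))
                (cover-terms-sum n L x) ⟩
    (x j * S + 0#) + sumVars L x * S   ≈⟨ +-congʳ (+-identityʳ _) ⟩
    x j * S + sumVars L x * S          ≈⟨ distribʳ S (x j) (sumVars L x) ⟨
    (x j + sumVars L x) * S            ∎
    where
      t = sumVars (others j) x
      S = ⟦ sumX n ⟧ x ⊝ᵛ 2#

  h₂∈Σ𝒢 : ∀ n → SigmaG (𝒢 (suc n)) 1 (h₂ (suc n))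
  h₂∈Σ𝒢 n =
    2 , 𝒢-MaxDeg n , sumSq [] , ([] , [] , λ _ → refl) ,
    concatMap cover-terms (allFin (suc n)) ,
    concat⁺ (map⁺ (universal cover-terms-valid (allFin (suc n)))) ,
    λ x → trans (sym (cover-terms-sum (suc n) (allFin (suc n)) x)) (sym (+-identityˡ _))
    where
      cover-terms-valid : ∀ j →
        All (λ { (s , g) → g ∈ 𝒢 (suc n) × SOS 1 s }) (cover-terms j)
      cover-terms-valid j =
        (coverCon∈𝒢 (suc n) j , square-SOS 1 (var j) ℕ.≤-refl) ∷
        (booleanity∈𝒢 (suc n) j , square-SOS 1 (½[2-g] j) (coverCon-sdeg (suc n) j)) ∷
        (-booleanity∈𝒢 (suc n) j , square-SOS 1 (½g j) (coverCon-sdeg (suc n) j)) ∷ []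

lemma29 : ∀ {c ℓ₁ ℓ₂} (R : RealClosedField c ℓ₁ ℓ₂) (n : ℕ) → 2 ≤ n →
          Poly.SigmaG R (Poly.𝒢 R n) 0 (Poly.h₁ R n) ×
          Poly.SigmaG R (Poly.𝒢 R n) 1 (Poly.h₂ R n)
lemma29 R zero    ()
lemma29 R (suc n) _  = h₁∈Σ𝒢 n , h₂∈Σ𝒢 n
  where open Certificates R
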